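{- Let $0<\gamma\le 1/2$, let $r\ge 1$ be an integer, let $G$ be a graph, and let $S_1,\dots,S_r$ be pairwise disjoint nonempty subsets of $V(G)$ such that the sequence $S_1,\dots,S_r$ is $(\gamma^{r-1},\gamma^{r-1},\gamma)$-full. Then $G$ contains a copy of $K_r$ with exactly one vertex in each of $S_1,\dots,S_r$.
   Context: All graphs are finite and simple. For disjoint $A,B\subseteq V(G)$ and $\gamma>0$, a vertex $v$ is $\gamma$-dense to $A$ if it has at least $\gamma|A|$ neighbours in $A$, and $B$ is $\gamma$-dense to $A$ if every vertex of $B$ is. For $\alpha,\beta,\gamma>0$, the pair $(A,B)$ is $(\alpha,\beta,\gamma)$-full if for every $X\subseteq A$ with $|X|\ge \alpha|A|$, all but at most $\beta|B|$ of the vertices of $B$ have at least $\gamma|X|$ neighbours in $X$. A sequence of pairwise disjoint sets $S_1,\dots,S_r$ is $(\alpha,\beta,\gamma)$-full if the pair $(S_i,S_j)$ is $(\alpha,\beta,\gamma)$-full for every $1\le i<j\le r$.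
   Formalization: The parameter γ is taken to be rational. -}

module Defs where

open import Data.Nat as ℕ using (ℕ; zero; suc)
open import Data.Integer using (+_)
open import Data.Rational using (ℚ; _/_; _*_; _≤_; 1ℚ)
open import Data.Bool using (Bool; true; false)
open import Data.Fin using (Fin; _<_)
open import Data.Fin.Subset using (Subset; _∈_; _⊆_; _∩_; ∣_∣; Nonempty; Empty)
open import Data.Vec using (tabulate)
open import Data.Product using (Σ; _×_; ∃)
open import Relation.Binary.PropositionalEquality using (_≡_; _≢_)
open import Relation.Nullary using (¬_)

ℕtoℚ : ℕ → ℚ
ℕtoℚ k = + k / 1

_^ℚ_ : ℚ → ℕ → ℚ
q ^ℚ zero  = 1ℚ
q ^ℚ suc k = q * (q ^ℚ k)

record Graph (n : ℕ) : Set where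
  field
    adj    : Fin n → Fin n → Bool
    sym    : ∀ u v → adj u v ≡ adj v u
    irrefl : ∀ v → adj v v ≡ false

open Graph public

N : ∀ {n} → Graph n → Fin n → Subset n
N G v = tabulate (adj G v)

degIn : ∀ {n} → Graph n → Fin n → Subset n → ℕ
degIn G v X = ∣ N G v ∩ X ∣

DenseTo : ∀ {n} → Graph n → ℚ → Fin n → Subset n → Set
DenseTo G γ v X = γ * ℕtoℚ ∣ X ∣ ≤ ℕtoℚ (degIn G v X)

-- (A,B) is (α,β,γ)-full: for every X ⊆ A with |X| ≥ α|A|, all but at most β|B|
-- vertices of B have at least γ|X| neighbours in X; "all but at most" is expressed
-- by an exceptional set E ⊆ B with |E| ≤ β|B| outside of which every vertex of B is good.
Full : ∀ {n} → Graph n → ℚ → ℚ → ℚ → Subset n → Subset n → Set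
Full {n} G α β γ A B =
  ∀ (X : Subset n) → X ⊆ A → α * ℕtoℚ ∣ A ∣ ≤ ℕtoℚ ∣ X ∣ →
    Σ (Subset n) λ E → E ⊆ B × ℕtoℚ ∣ E ∣ ≤ β * ℕtoℚ ∣ B ∣ ×
      (∀ v → v ∈ B → ¬ (v ∈ E) → DenseTo G γ v X)

PairwiseDisjoint : ∀ {n r} → (Fin r → Subset n) → Set
PairwiseDisjoint {n} {r} S = ∀ (i j : Fin r) → i ≢ j → ∀ (v : Fin n) → v ∈ S i → ¬ (v ∈ S j)

FullSeq : ∀ {n r} → Graph n → ℚ → ℚ → ℚ → (Fin r → Subset n) → Set
FullSeq {n} {r} G α β γ S = ∀ (i j : Fin r) → i < j → Full G α β γ (S i) (S j)

-- G contains a copy of K_r with exactly one vertex in each S_i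
-- (a choice f i ∈ S i, pairwise adjacent; distinctness follows from adjacency/irreflexivity)
TransversalClique : ∀ {n r} → Graph n → (Fin r → Subset n) → Set
TransversalClique {n} {r} G S =
  Σ (Fin r → Fin n) λ f → (∀ i → f i ∈ S i) × (∀ i j → i ≢ j → adj G (f i) (f j) ≡ true)

{-# OPTIONS --safe #-}
-- Fullness of (S_i , S_r) applied to X = S_i gives, for each i < r, an exceptional
-- subset of S_r of size at most γ^(r-1)|S_r|; since (r-1)γ^(r-1) < 1 some v ∈ S_r
-- avoids all of them, so v has at least γ|S_i| neighbours in every S_i. A subset of
-- N(v) ∩ S_i of relative size γ^(r-2) has relative size at least γ^(r-1) in S_i, so
-- the sets N(v) ∩ S_i (i < r) are (γ^(r-2),γ^(r-2),γ)-full, and a transversal clique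
-- of them, found by induction, extends by v.
module Submission where

open import Defs
open import Data.Nat using (ℕ; _∸_) renaming (_≤_ to _≤ℕ_)
open import Data.Integer using (+_)
open import Data.Rational using (ℚ; _<_; _≤_; 0ℚ; ½)
open import Data.Fin using (Fin)
open import Data.Fin.Subset using (Subset; Nonempty)

open import Data.Nat as ℕ using (zero; suc; z≤n; s≤s)
import Data.Nat.Properties as ℕₚ
import Data.Nat.Coprimality as Coprimality
import Data.Integer as ℤ
import Data.Integer.Properties as ℤₚ
open import Data.Rational using (mkℚ; 1ℚ; _+_; _*_; _/_; *≤*; *<*; NonNegative; positive; nonNegative)
open import Data.Rational.Properties
open import Data.Rational.Solver using (module +-*-Solver)
open import Data.Fin as Fin using (zero; suc; opposite)
import Data.Fin.Properties as Finₚ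
open import Data.Fin.Subset using (_∈_; _∉_; _⊆_; _∩_; _∪_; ⊥; ⋃; ∣_∣; inside; outside)
open import Data.Fin.Subset.Properties
open import Data.List using (tabulate)
open import Data.Bool using (true)
open import Data.Vec using (_∷_; [])
open import Data.Vec.Properties using ([]=⇒lookup; lookup∘tabulate)
open import Data.Product using (∃; _×_; _,_; proj₁; proj₂)
open import Function using (_∘_)
open import Relation.Binary.PropositionalEquality
  using (_≡_; _≢_; refl; trans; cong; cong₂; subst)
  renaming (sym to ≡-sym)
open import Relation.Nullary using (contradiction; yes; no)
open import Relation.Nullary.Decidable using (_→-dec_)

ℕtoℚ≡mkℚ : ∀ k → ℕtoℚ k ≡ mkℚ (+ k) 0 (Coprimality.sym (Coprimality.1-coprimeTo k))
ℕtoℚ≡mkℚ k = normalize-coprime _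

ℕtoℚ-mono-≤ : ∀ {a b} → a ℕ.≤ b → ℕtoℚ a ≤ ℕtoℚ b
ℕtoℚ-mono-≤ {a} {b} a≤b rewrite ℕtoℚ≡mkℚ a | ℕtoℚ≡mkℚ b =
  *≤* (ℤₚ.*-monoʳ-≤-nonNeg (+ 1) (ℤ.+≤+ a≤b))

ℕtoℚ-cancel-< : ∀ {a b} → ℕtoℚ a < ℕtoℚ b → a ℕ.< b
ℕtoℚ-cancel-< {a} {b} a<b rewrite ℕtoℚ≡mkℚ a | ℕtoℚ≡mkℚ b with a<b
... | *<* a*1<b*1 = ℤₚ.drop‿+<+ (ℤₚ.*-cancelʳ-<-nonNeg (+ 1) a*1<b*1)

ℕtoℚ-homo-+ : ∀ a b → ℕtoℚ (a ℕ.+ b) ≡ ℕtoℚ a + ℕtoℚ b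
ℕtoℚ-homo-+ a b rewrite ℕtoℚ≡mkℚ a | ℕtoℚ≡mkℚ b =
  cong (_/ 1) (trans (ℤₚ.pos-+ a b) (≡-sym (cong₂ ℤ._+_ (ℤₚ.*-identityʳ (+ a)) (ℤₚ.*-identityʳ (+ b)))))

ℕtoℚ-nonNeg : ∀ k → NonNegative (ℕtoℚ k)
ℕtoℚ-nonNeg k = nonNegative (ℕtoℚ-mono-≤ (z≤n {k}))

½≤1 : ½ ≤ 1ℚ
½≤1 = *≤* (ℤ.+≤+ (s≤s z≤n))

^ℚ-pos : ∀ {p} → 0ℚ < p → ∀ k → 0ℚ < p ^ℚ k
^ℚ-pos p>0 zero    = positive⁻¹ 1ℚ
^ℚ-pos {p} p>0 (suc k) =
  positive⁻¹ _ {{pos*pos⇒pos p {{positive p>0}} (p ^ℚ k) {{positive (^ℚ-pos p>0 k)}}}}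

^ℚ≤1 : ∀ {p} → 0ℚ ≤ p → p ≤ 1ℚ → ∀ k → p ^ℚ k ≤ 1ℚ
^ℚ≤1 p≥0 p≤1 zero    = ≤-refl
^ℚ≤1 {p} p≥0 p≤1 (suc k) = begin
  p * p ^ℚ k  ≤⟨ *-monoˡ-≤-nonNeg p {{nonNegative p≥0}} (^ℚ≤1 p≥0 p≤1 k) ⟩
  p * 1ℚ      ≡⟨ *-identityʳ p ⟩
  p           ≤⟨ p≤1 ⟩
  1ℚ          ∎
  where open ≤-Reasoning

*^ℚ<1 : ∀ {p} → 0ℚ < p → p ≤ ½ → ∀ k → ℕtoℚ k * p ^ℚ k < 1ℚ
*^ℚ<1 p>0 p≤½ zero    = positive⁻¹ 1ℚ
*^ℚ<1 {p} p>0 p≤½ (suc k) = begin-strict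
  ℕtoℚ (suc k) * (p * p ^ℚ k)     ≡⟨ cong (_* (p * p ^ℚ k)) (ℕtoℚ-homo-+ 1 k) ⟩
  (1ℚ + ℕtoℚ k) * (p * p ^ℚ k)    ≡⟨ solve 3 (λ a q x → (con 1ℚ :+ a) :* (q :* x) := q :* (a :* x :+ x))
                                           refl (ℕtoℚ k) p (p ^ℚ k) ⟩
  p * (ℕtoℚ k * p ^ℚ k + p ^ℚ k)  <⟨ *-monoʳ-<-pos p {{positive p>0}}
                                       (+-mono-<-≤ (*^ℚ<1 p>0 p≤½ k) (^ℚ≤1 (<⇒≤ p>0) (≤-trans p≤½ ½≤1) k)) ⟩
  p * (1ℚ + 1ℚ)                   ≤⟨ *-monoʳ-≤-nonNeg (1ℚ + 1ℚ) p≤½ ⟩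
  ½ * (1ℚ + 1ℚ)                   ≡⟨⟩
  1ℚ                              ∎
  where
  open ≤-Reasoning
  open +-*-Solver

∣p∪q∣≤∣p∣+∣q∣ : ∀ {n} (p q : Subset n) → ∣ p ∪ q ∣ ℕ.≤ ∣ p ∣ ℕ.+ ∣ q ∣
∣p∪q∣≤∣p∣+∣q∣ []          []          = z≤n
∣p∪q∣≤∣p∣+∣q∣ (inside ∷ p)  (inside ∷ q)  =
  s≤s (ℕₚ.≤-trans (∣p∪q∣≤∣p∣+∣q∣ p q) (ℕₚ.+-monoʳ-≤ ∣ p ∣ (ℕₚ.n≤1+n ∣ q ∣)))
∣p∪q∣≤∣p∣+∣q∣ (inside ∷ p)  (outside ∷ q) = s≤s (∣p∪q∣≤∣p∣+∣q∣ p q)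
∣p∪q∣≤∣p∣+∣q∣ (outside ∷ p) (inside ∷ q)  =
  ℕₚ.≤-trans (s≤s (∣p∪q∣≤∣p∣+∣q∣ p q)) (ℕₚ.≤-reflexive (≡-sym (ℕₚ.+-suc ∣ p ∣ ∣ q ∣)))
∣p∪q∣≤∣p∣+∣q∣ (outside ∷ p) (outside ∷ q) = ∣p∪q∣≤∣p∣+∣q∣ p q

∣q∣<∣p∣⇒∃∈p∉q : ∀ {n} {p q : Subset n} → ∣ q ∣ ℕ.< ∣ p ∣ → ∃ λ x → x ∈ p × x ∉ q
∣q∣<∣p∣⇒∃∈p∉q {n} {p} {q} ∣q∣<∣p∣
  with Finₚ.¬∀⟶∃¬ n (λ x → x ∈ p → x ∈ q) (λ x → x ∈? p →-dec x ∈? q)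
         (λ p⊆q → ℕₚ.<⇒≱ ∣q∣<∣p∣ (p⊆q⇒∣p∣≤∣q∣ (p⊆q _)))
... | x , p⊈q with x ∈? p
...   | yes x∈p = x , x∈p , λ x∈q → p⊈q (λ _ → x∈q)
...   | no  x∉p = contradiction (λ x∈p → contradiction x∈p x∉p) p⊈q

Nonempty⇒0<∣p∣ : ∀ {n} {p : Subset n} → Nonempty p → 0 ℕ.< ∣ p ∣
Nonempty⇒0<∣p∣ (x , x∈p) = ℕₚ.≤-<-trans z≤n (x∈p⇒∣p-x∣<∣p∣ x∈p)

0<ℕtoℚ∣p∣ : ∀ {n} {p : Subset n} → Nonempty p → 0ℚ < ℕtoℚ ∣ p ∣
0<ℕtoℚ∣p∣ p≠∅ = <-≤-trans (positive⁻¹ 1ℚ) (ℕtoℚ-mono-≤ (Nonempty⇒0<∣p∣ p≠∅))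

0<∣p∣⇒Nonempty : ∀ {n} {p : Subset n} → 0 ℕ.< ∣ p ∣ → Nonempty p
0<∣p∣⇒Nonempty {n} {p} 0<∣p∣ with ∣q∣<∣p∣⇒∃∈p∉q {q = ⊥} (subst (ℕ._< ∣ p ∣) (≡-sym (∣⊥∣≡0 n)) 0<∣p∣)
... | x , x∈p , _ = x , x∈p

module _ {n : ℕ} where

  ⊆⋃-tabulate : ∀ {m} (E : Fin m → Subset n) a → E a ⊆ ⋃ (tabulate E)
  ⊆⋃-tabulate E zero    x∈E₀ = p⊆p∪q _ x∈E₀
  ⊆⋃-tabulate E (suc a) x∈Eₐ = q⊆p∪q (E zero) _ (⊆⋃-tabulate (E ∘ suc) a x∈Eₐ)

  ∣⋃-tabulate∣≤ : ∀ {m} (E : Fin m → Subset n) {c} →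
                  (∀ a → ℕtoℚ ∣ E a ∣ ≤ c) → ℕtoℚ ∣ ⋃ (tabulate E) ∣ ≤ ℕtoℚ m * c
  ∣⋃-tabulate∣≤ {zero} E {c} _ = ≤-reflexive (trans (cong ℕtoℚ (∣⊥∣≡0 n)) (≡-sym (*-zeroˡ c)))
  ∣⋃-tabulate∣≤ {suc m} E {c} ∣E∣≤c = begin
    ℕtoℚ ∣ E₀ ∪ U ∣                ≤⟨ ℕtoℚ-mono-≤ (∣p∪q∣≤∣p∣+∣q∣ E₀ U) ⟩
    ℕtoℚ (∣ E₀ ∣ ℕ.+ ∣ U ∣)         ≡⟨ ℕtoℚ-homo-+ ∣ E₀ ∣ ∣ U ∣ ⟩
    ℕtoℚ ∣ E₀ ∣ + (ℕtoℚ ∣ U ∣)      ≤⟨ +-mono-≤ (∣E∣≤c zero) (∣⋃-tabulate∣≤ (E ∘ suc) (∣E∣≤c ∘ suc)) ⟩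
    c + ℕtoℚ m * c                 ≡⟨ solve 2 (λ c k → c :+ k :* c := (con 1ℚ :+ k) :* c) refl c (ℕtoℚ m) ⟩
    (1ℚ + ℕtoℚ m) * c              ≡⟨ cong (_* c) (ℕtoℚ-homo-+ 1 m) ⟨
    ℕtoℚ (suc m) * c               ∎
    where
    open ≤-Reasoning
    open +-*-Solver
    E₀ U : Subset n
    E₀ = E zero
    U  = ⋃ (tabulate (E ∘ suc))

  ∃-∈-avoiding : ∀ {m} (E : Fin m → Subset n) {c} (S : Subset n) →
                 (∀ a → ℕtoℚ ∣ E a ∣ ≤ c) → ℕtoℚ m * c < ℕtoℚ ∣ S ∣ →
                 ∃ λ x → x ∈ S × ∀ a → x ∉ E a
  ∃-∈-avoiding E S ∣E∣≤c mc<∣S∣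
    with ∣q∣<∣p∣⇒∃∈p∉q (ℕtoℚ-cancel-< (≤-<-trans (∣⋃-tabulate∣≤ E ∣E∣≤c) mc<∣S∣))
  ... | x , x∈S , x∉⋃E = x , x∈S , λ a x∈Eₐ → x∉⋃E (⊆⋃-tabulate E a x∈Eₐ)

-- Reversed order, so that the set in which the next clique vertex is chosen
-- (the paper's S_r) has index zero.
FullSeqᵒᵖ : ∀ {n r} → Graph n → ℚ → ℚ → ℚ → (Fin r → Subset n) → Set
FullSeqᵒᵖ G α β γ T = ∀ i j → j Fin.< i → Full G α β γ (T i) (T j)

opposite-reverses-< : ∀ {m} {i j : Fin m} → j Fin.< i → opposite i Fin.< opposite j
opposite-reverses-< {suc m} {i} {j} j<i rewrite Finₚ.opposite-prop i | Finₚ.opposite-prop j =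
  ℕₚ.∸-monoʳ-< (s≤s j<i) (Finₚ.toℕ<n i)

module _ {n : ℕ} (G : Graph n) where

  ∈N⇒adj : ∀ {v w} → w ∈ N G v → adj G v w ≡ true
  ∈N⇒adj {v} {w} w∈Nv = trans (≡-sym (lookup∘tabulate (adj G v) w)) ([]=⇒lookup w∈Nv)

  Full-restrict : ∀ {α β α′ β′ γ} {A B A′ B′ : Subset n} → A′ ⊆ A → B′ ⊆ B →
                  α * ℕtoℚ ∣ A ∣ ≤ α′ * ℕtoℚ ∣ A′ ∣ → β * ℕtoℚ ∣ B ∣ ≤ β′ * ℕtoℚ ∣ B′ ∣ →
                  Full G α β γ A B → Full G α′ β′ γ A′ B′
  Full-restrict {B′ = B′} A′⊆A B′⊆B αA≤α′A′ βB≤β′B′ full X X⊆A′ α′A′≤X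
    with full X (A′⊆A ∘ X⊆A′) (≤-trans αA≤α′A′ α′A′≤X)
  ... | E , E⊆B , ∣E∣≤βB , dense =
    B′ ∩ E ,
    p∩q⊆p B′ E ,
    ≤-trans (ℕtoℚ-mono-≤ (∣p∩q∣≤∣q∣ B′ E)) (≤-trans ∣E∣≤βB βB≤β′B′) ,
    λ w w∈B′ w∉B′∩E → dense w (B′⊆B w∈B′) (λ w∈E → w∉B′∩E (x∈p∩q⁺ (w∈B′ , w∈E)))

  DenseTo-rescale : ∀ {α γ v} {A : Subset n} → 0ℚ ≤ α → DenseTo G γ v A →
                    (γ * α) * ℕtoℚ ∣ A ∣ ≤ α * ℕtoℚ ∣ N G v ∩ A ∣
  DenseTo-rescale {α} {γ} {v} {A} α≥0 γA≤deg = begin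
    (γ * α) * ℕtoℚ ∣ A ∣      ≡⟨ solve 3 (λ g a x → (g :* a) :* x := a :* (g :* x)) refl γ α (ℕtoℚ ∣ A ∣) ⟩
    α * (γ * ℕtoℚ ∣ A ∣)      ≤⟨ *-monoˡ-≤-nonNeg α {{nonNegative α≥0}} γA≤deg ⟩
    α * ℕtoℚ ∣ N G v ∩ A ∣   ∎
    where
    open ≤-Reasoning
    open +-*-Solver

  DenseTo⇒Nonempty : ∀ {γ v} {A : Subset n} → 0ℚ < γ → Nonempty A → DenseTo G γ v A →
                     Nonempty (N G v ∩ A)
  DenseTo⇒Nonempty {γ} {A = A} γ>0 A≠∅ γA≤deg = 0<∣p∣⇒Nonempty (ℕtoℚ-cancel-< {0} (<-≤-trans γA>0 γA≤deg))
    where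
    γA>0 : 0ℚ < γ * ℕtoℚ ∣ A ∣
    γA>0 = positive⁻¹ _ {{pos*pos⇒pos γ {{positive γ>0}} (ℕtoℚ ∣ A ∣) {{positive (0<ℕtoℚ∣p∣ A≠∅)}}}}

  ∃-dense-to-all : ∀ {m α β γ} {B : Subset n} (A : Fin m → Subset n) →
                   α ≤ 1ℚ → ℕtoℚ m * β < 1ℚ → Nonempty B →
                   (∀ a → Full G α β γ (A a) B) →
                   ∃ λ v → v ∈ B × ∀ a → DenseTo G γ v (A a)
  ∃-dense-to-all {m} {α} {β} {γ} {B} A α≤1 mβ<1 B≠∅ full =
    dense (∃-∈-avoiding (proj₁ ∘ exceptional) B (proj₁ ∘ proj₂ ∘ proj₂ ∘ exceptional) mβB<∣B∣)
    where
    exceptional : ∀ a → ∃ λ E → E ⊆ B × ℕtoℚ ∣ E ∣ ≤ β * ℕtoℚ ∣ B ∣ ×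
                                (∀ v → v ∈ B → v ∉ E → DenseTo G γ v (A a))
    exceptional a = full a (A a) ⊆-refl (begin
      α * ℕtoℚ ∣ A a ∣   ≤⟨ *-monoʳ-≤-nonNeg (ℕtoℚ ∣ A a ∣) {{ℕtoℚ-nonNeg ∣ A a ∣}} α≤1 ⟩
      1ℚ * ℕtoℚ ∣ A a ∣  ≡⟨ *-identityˡ _ ⟩
      ℕtoℚ ∣ A a ∣       ∎)
      where open ≤-Reasoning
    mβB<∣B∣ : ℕtoℚ m * (β * ℕtoℚ ∣ B ∣) < ℕtoℚ ∣ B ∣
    mβB<∣B∣ = begin-strict
      ℕtoℚ m * (β * ℕtoℚ ∣ B ∣)  ≡⟨ *-assoc (ℕtoℚ m) β _ ⟨
      (ℕtoℚ m * β) * ℕtoℚ ∣ B ∣  <⟨ *-monoˡ-<-pos (ℕtoℚ ∣ B ∣) {{positive (0<ℕtoℚ∣p∣ B≠∅)}} mβ<1 ⟩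
      1ℚ * ℕtoℚ ∣ B ∣            ≡⟨ *-identityˡ _ ⟩
      ℕtoℚ ∣ B ∣                 ∎
      where open ≤-Reasoning
    dense : (∃ λ v → v ∈ B × ∀ a → v ∉ proj₁ (exceptional a)) →
            ∃ λ v → v ∈ B × ∀ a → DenseTo G γ v (A a)
    dense (v , v∈B , v∉E) = v , v∈B , λ a → proj₂ (proj₂ (proj₂ (exceptional a))) v v∈B (v∉E a)

  TransversalClique-cons : ∀ {r v} {T : Fin (suc r) → Subset n} → v ∈ T zero →
                           TransversalClique G (λ a → N G v ∩ T (suc a)) → TransversalClique G T
  TransversalClique-cons {r} {v} {T} v∈T₀ (g , g∈ , g-adj) = f , f∈ , f-adj
    where
    v-adj : ∀ a → adj G v (g a) ≡ true
    v-adj a = ∈N⇒adj (p∩q⊆p _ _ (g∈ a))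
    f : Fin (suc r) → Fin n
    f zero    = v
    f (suc a) = g a
    f∈ : ∀ i → f i ∈ T i
    f∈ zero    = v∈T₀
    f∈ (suc a) = p∩q⊆q _ _ (g∈ a)
    f-adj : ∀ i j → i ≢ j → adj G (f i) (f j) ≡ true
    f-adj zero    zero    0≢0 = contradiction refl 0≢0
    f-adj zero    (suc b) _   = v-adj b
    f-adj (suc a) zero    _   = trans (Graph.sym G (g a) v) (v-adj a)
    f-adj (suc a) (suc b) a≢b = g-adj a b (a≢b ∘ cong suc)

  TransversalClique-reindex : ∀ {r s} {S : Fin r → Subset n} (σ : Fin s → Fin r) (τ : Fin r → Fin s) →
                              (∀ i → σ (τ i) ≡ i) → TransversalClique G (S ∘ σ) → TransversalClique G S
  TransversalClique-reindex {S = S} σ τ στ≗id (f , f∈ , f-adj) =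
    f ∘ τ ,
    (λ i → subst (λ j → f (τ i) ∈ S j) (στ≗id i) (f∈ (τ i))) ,
    λ i j i≢j → f-adj (τ i) (τ j) (λ τi≡τj → i≢j (trans (≡-sym (στ≗id i)) (trans (cong σ τi≡τj) (στ≗id j))))

  module _ {γ : ℚ} (γ>0 : 0ℚ < γ) (γ≤½ : γ ≤ ½) where

    transversalClique : ∀ r (T : Fin (suc r) → Subset n) → (∀ i → Nonempty (T i)) →
                        FullSeqᵒᵖ G (γ ^ℚ r) (γ ^ℚ r) γ T → TransversalClique G T
    transversalClique zero T T≠∅ _ =
      (λ _ → proj₁ (T≠∅ zero)) , (λ { zero → proj₂ (T≠∅ zero) }) , λ { zero zero 0≢0 → contradiction refl 0≢0 }
    transversalClique (suc r) T T≠∅ full =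
      extend (∃-dense-to-all {γ = γ} (T ∘ suc)
                (^ℚ≤1 (<⇒≤ γ>0) (≤-trans γ≤½ ½≤1) (suc r)) (*^ℚ<1 γ>0 γ≤½ (suc r))
                (T≠∅ zero) (λ a → full (suc a) zero (s≤s z≤n)))
      where
      extend : (∃ λ v → v ∈ T zero × ∀ a → DenseTo G γ v (T (suc a))) → TransversalClique G T
      extend (v , v∈T₀ , dense) = TransversalClique-cons v∈T₀ (transversalClique r T′ T′≠∅ full′)
        where
        T′ : Fin (suc r) → Subset n
        T′ a = N G v ∩ T (suc a)
        T′≠∅ : ∀ a → Nonempty (T′ a)
        T′≠∅ a = DenseTo⇒Nonempty γ>0 (T≠∅ (suc a)) (dense a)
        shrink : ∀ a → γ ^ℚ suc r * ℕtoℚ ∣ T (suc a) ∣ ≤ γ ^ℚ r * ℕtoℚ ∣ T′ a ∣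
        shrink a = DenseTo-rescale {γ = γ} (<⇒≤ (^ℚ-pos γ>0 r)) (dense a)
        full′ : FullSeqᵒᵖ G (γ ^ℚ r) (γ ^ℚ r) γ T′
        full′ i j j<i =
          Full-restrict {α = γ ^ℚ suc r} {β = γ ^ℚ suc r} {α′ = γ ^ℚ r} {β′ = γ ^ℚ r} {γ = γ}
            (p∩q⊆q _ _) (p∩q⊆q _ _) (shrink i) (shrink j) (full (suc i) (suc j) (s≤s j<i))

lemma13 : (γ : ℚ) → 0ℚ < γ → γ ≤ ½ →
    (r : ℕ) → 1 ≤ℕ r →
    {n : ℕ} (G : Graph n) (S : Fin r → Subset n) →
    PairwiseDisjoint S → (∀ i → Nonempty (S i)) →
    FullSeq G (γ ^ℚ (r ∸ 1)) (γ ^ℚ (r ∸ 1)) γ S →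
    TransversalClique G S
lemma13 γ γ>0 γ≤½ (suc r) _ G S _ S≠∅ full =
  TransversalClique-reindex G opposite opposite Finₚ.opposite-involutive
    (transversalClique G γ>0 γ≤½ r (S ∘ opposite) (S≠∅ ∘ opposite)
      (λ i j j<i → full (opposite i) (opposite j) (opposite-reverses-< j<i)))
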